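{- Let $p,q,a_0,a_1$ be integers with $q\ne0$ and $\Delta=p^2+4q>0$, $\alpha=\frac{p+\sqrt\Delta}{2}$, $\beta=\frac{p-\sqrt\Delta}{2}$, $A=a_1-a_0\beta$, $B=a_1-a_0\alpha$, and let $(w_k)_{k\in\mathbb{Z}}$ be the Horadam sequence $w_0=a_0$, $w_1=a_1$, $w_{k+1}=pw_k+qw_{k-1}$ extended to negative indices by $w_{k-1}=(w_{k+1}-pw_k)/q$. Let $N\ge1$, $K$ a field containing $\mathbb{R}$ and a primitive $N$-th root of unity $\omega$, $a,b\in K^*$, $S=\big(\frac{a,b}{K,\omega}\big)$ with ordered basis $e_0,\dots,e_{N^2-1}$, $W_k=\sum_{l=0}^{N^2-1}w_{k+l}e_l$ ($k\in\mathbb Z$), $\underline\alpha=\sum_l\alpha^le_l$, $\underline\beta=\sum_l\beta^le_l$. Then for all $n,r\in\mathbb{Z}$: (a) $W_{n-r}W_{n+r}-W_n^2=\dfrac{AB(-q)^{n-r}(\alpha^r-\beta^r)(\beta^r\underline\alpha\underline\beta-\alpha^r\underline\beta\underline\alpha)}{\Delta}$; (b) $W_{n+r}W_{n-r}-W_n^2=\dfrac{AB(-q)^{n-r}(\alpha^r-\beta^r)(\beta^r\underline\beta\underline\alpha-\alpha^r\underline\alpha\underline\beta)}{\Delta}$.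
   Context: The symbol algebra $\big(\frac{a,b}{K,\omega}\big)$ is the associative (noncommutative) $K$-algebra generated by $x,y$ with $x^N=a$, $y^N=b$, $yx=\omega xy$, with $K$-basis $\{x^iy^j:0\le i,j<N\}$ ordered as $e_{jN+i}=x^iy^j$; all products are taken in this algebra. -}

module Defs where

open import Level using (Level; suc; _⊔_)
open import Algebra.Bundles using (CommutativeRing)
open import Data.Nat as ℕ using (ℕ; zero; _≤ᵇ_; _∸_)
open import Data.Bool using (if_then_else_)
open import Data.Integer as ℤ using (ℤ; +_; -[1+_])
open import Data.Product using (_×_; _,_; proj₁)
open import Relation.Nullary using (¬_)

-- A field: a commutative ring with 0 ≠ 1 in which every nonzero element is
-- invertible (the inverse is given as a total operation, as in stdlib's ℚ).
record Field c ℓ : Set (suc (c ⊔ ℓ)) where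
  field
    commutativeRing : CommutativeRing c ℓ
  open CommutativeRing commutativeRing public
  field
    _⁻¹        : Carrier → Carrier
    0≉1        : ¬ (0# ≈ 1#)
    ⁻¹-inverse : ∀ x → ¬ (x ≈ 0#) → x * (x ⁻¹) ≈ 1#

module Ops {c ℓ} (F : Field c ℓ) where
  open Field F

  fromℕ : ℕ → Carrier
  fromℕ zero      = 0#
  fromℕ (ℕ.suc n) = 1# + fromℕ n

  ι : ℤ → Carrier
  ι (+ n)    = fromℕ n
  ι -[1+ n ] = - fromℕ (ℕ.suc n)

  pow : Carrier → ℕ → Carrier
  pow x zero      = 1#
  pow x (ℕ.suc n) = x * pow x n

  zpow : Carrier → ℤ → Carrier
  zpow x (+ n)    = pow x n
  zpow x -[1+ n ] = pow (x ⁻¹) (ℕ.suc n)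

  PrimitiveRoot : Carrier → ℕ → Set ℓ
  PrimitiveRoot ω N =
    pow ω N ≈ 1# × (∀ k → 0 ℕ.< k → k ℕ.< N → ¬ (pow ω k ≈ 1#))

  module Horadam (p q a₀ a₁ : ℤ) where
    -- fwd n = (w_n , w_{n+1})
    fwd : ℕ → Carrier × Carrier
    fwd zero      = ι a₀ , ι a₁
    fwd (ℕ.suc n) with fwd n
    ... | (u , v) = v , (ι p * v + ι q * u)

    -- bwd n = (w_{-n} , w_{-n+1})
    bwd : ℕ → Carrier × Carrier
    bwd zero      = ι a₀ , ι a₁
    bwd (ℕ.suc n) with bwd n
    ... | (u , v) = ((v - ι p * u) * (ι q ⁻¹)) , u

    w : ℤ → Carrier
    w (+ n)    = proj₁ (fwd n)
    w -[1+ n ] = proj₁ (bwd (ℕ.suc n))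

  -- An element
  -- Σ_{i,j<N} c(i,j) x^i y^j  is represented by its coefficient function
  -- c : ℕ → ℕ → K (only the values at i,j < N matter; the basis vector
  -- e_{jN+i} = x^i y^j has coefficient c i j).
  module Symbol (N : ℕ) (ω a b : Carrier) where
    infix  4 _≋_
    infixl 6 _⊕_ _⊖_
    infixr 7 _·_
    infixl 7 _⊛_

    Elt : Set c
    Elt = ℕ → ℕ → Carrier

    _≋_ : Elt → Elt → Set ℓ
    u ≋ v = ∀ i j → i ℕ.< N → j ℕ.< N → u i j ≈ v i j

    sumTo : ℕ → (ℕ → Carrier) → Carrier
    sumTo zero      f = 0#
    sumTo (ℕ.suc n) f = sumTo n f + f n

    fromSeq : (ℕ → Carrier) → Elt
    fromSeq f i j = f (j ℕ.* N ℕ.+ i)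

    _⊕_ : Elt → Elt → Elt
    (u ⊕ v) i j = u i j + v i j

    _⊖_ : Elt → Elt → Elt
    (u ⊖ v) i j = u i j - v i j

    _·_ : Carrier → Elt → Elt
    (k · u) i j = k * u i j

    -- Product, from x^i y^j · x^k y^l = ω^{jk} x^{i+k} y^{j+l} together with
    -- x^N = a, y^N = b.  The coefficient of x^m y^n in u v collects the
    -- terms with i + k ≡ m, j + l ≡ n (mod N), i.e. k = m - i (+N if i > m),
    -- picking up a factor a (resp. b) when the exponent wraps around.
    _⊛_ : Elt → Elt → Elt
    (u ⊛ v) m n =
      sumTo N λ i → sumTo N λ j →
        let k = if i ≤ᵇ m then m ∸ i else (m ℕ.+ N) ∸ i
            l = if j ≤ᵇ n then n ∸ j else (n ℕ.+ N) ∸ j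
        in u i j * v k l * pow ω (j ℕ.* k)
             * (if i ≤ᵇ m then 1# else a)
             * (if j ≤ᵇ n then 1# else b)

-- Binet's formula √Δ·w_k = Aα^k − Bβ^k holds for every k ∈ ℤ (α and β both satisfy
-- x² = px + q), so √Δ·W_k = Aα^k·α̲ − Bβ^k·β̲.  Since the product is bilinear, Δ·W_u W_v is a
-- combination of α̲α̲, α̲β̲, β̲α̲, β̲β̲ with coefficients built from α^u, β^u, α^v, β^v.  For
-- (u, v) = (n − r, n + r) and (n, n) the coefficients of α̲α̲ and β̲β̲ agree and, using
-- αβ = −q, those of α̲β̲ and β̲α̲ differ by AB(−q)^{n−r}(α^r − β^r) times β^r and −α^r.
module Submission where

open import Defs
open import Data.Nat as ℕ using (ℕ; zero; suc)
import Data.Nat.Properties as ℕP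
open import Data.Integer as ℤ using (ℤ; +_; -[1+_])
import Data.Integer.Properties as ℤP
open import Data.Maybe using (Maybe; just; nothing)
open import Data.Product using (_×_; _,_; proj₁; proj₂)
open import Relation.Nullary using (yes; no; ¬_)
open import Relation.Binary.PropositionalEquality as ≡ using (_≡_; _≢_)
open import Algebra.Bundles using (CommutativeRing)
import Algebra.Solver.Ring.AlmostCommutativeRing as ACR

ℤ-induction : ∀ {p} (P : ℤ → Set p) → P (+ 0) →
              (∀ k → P k → P (ℤ.suc k)) → (∀ k → P (ℤ.suc k) → P k) → ∀ k → P k
ℤ-induction P P0 up down (+ zero)      = P0
ℤ-induction P P0 up down (+ suc n)     = up (+ n) (ℤ-induction P P0 up down (+ n))
ℤ-induction P P0 up down -[1+ zero ]   = down -[1+ 0 ] P0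
ℤ-induction P P0 up down -[1+ suc n ]  = down -[1+ suc n ] (ℤ-induction P P0 up down -[1+ n ])

suc-neg-suc : ∀ n → ℤ.suc (ℤ.- (+ suc n)) ≡ ℤ.- (+ n)
suc-neg-suc zero    = ≡.refl
suc-neg-suc (suc n) = ≡.refl

i-j+j≡i : ∀ i j → i ℤ.- j ℤ.+ j ≡ i
i-j+j≡i i j = ≡.trans (ℤP.+-assoc i (ℤ.- j) j)
                      (≡.trans (≡.cong (λ k → i ℤ.+ k) (ℤP.+-inverseˡ j)) (ℤP.+-identityʳ i))

module FieldTheory {c ℓ} (F : Field c ℓ) where
  open Field F
  open Ops F
  open import Relation.Binary.Reasoning.Setoid setoid
  open import Algebra.Properties.Ring ring
    using (-‿distribˡ-*; -‿involutive; -‿+-comm; -0#≈0#; x[y-z]≈xy-xz)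
  open import Algebra.Properties.Semiring.Mult semiring
    using (×-homo-+; ×1-homo-*) renaming (_×_ to _·ₙ_)
  open import Algebra.Properties.CommutativeSemigroup +-commutativeSemigroup
    using () renaming (interchange to +-interchange)
  open import Algebra.Properties.CommutativeSemigroup *-commutativeSemigroup
    using () renaming (interchange to *-interchange)

  fromℕ≈×1# : ∀ n → fromℕ n ≈ n ·ₙ 1#
  fromℕ≈×1# zero    = refl
  fromℕ≈×1# (suc n) = +-congˡ (fromℕ≈×1# n)

  fromℕ-+ : ∀ m n → fromℕ (m ℕ.+ n) ≈ fromℕ m + fromℕ n
  fromℕ-+ m n = begin
    fromℕ (m ℕ.+ n)     ≈⟨ fromℕ≈×1# (m ℕ.+ n) ⟩
    (m ℕ.+ n) ·ₙ 1#     ≈⟨ ×-homo-+ 1# m n ⟩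
    m ·ₙ 1# + n ·ₙ 1#   ≈⟨ +-cong (fromℕ≈×1# m) (fromℕ≈×1# n) ⟨
    fromℕ m + fromℕ n   ∎

  fromℕ-* : ∀ m n → fromℕ (m ℕ.* n) ≈ fromℕ m * fromℕ n
  fromℕ-* m n = begin
    fromℕ (m ℕ.* n)     ≈⟨ fromℕ≈×1# (m ℕ.* n) ⟩
    (m ℕ.* n) ·ₙ 1#     ≈⟨ ×1-homo-* m n ⟩
    m ·ₙ 1# * n ·ₙ 1#   ≈⟨ *-cong (fromℕ≈×1# m) (fromℕ≈×1# n) ⟨
    fromℕ m * fromℕ n   ∎

  ι-neg : ∀ i → ι (ℤ.- i) ≈ - ι i
  ι-neg -[1+ n ]  = sym (-‿involutive _)
  ι-neg (+ zero)  = sym -0#≈0#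
  ι-neg (+ suc n) = refl

  ι-⊖ : ∀ m n → ι (m ℤ.⊖ n) ≈ fromℕ m - fromℕ n
  ι-⊖ zero    zero    = sym (-‿inverseʳ 0#)
  ι-⊖ zero    (suc n) = sym (+-identityˡ _)
  ι-⊖ (suc m) zero    = sym (trans (+-congˡ -0#≈0#) (+-identityʳ _))
  ι-⊖ (suc m) (suc n) = begin
    ι (suc m ℤ.⊖ suc n)                 ≡⟨ ≡.cong ι (ℤP.[1+m]⊖[1+n]≡m⊖n m n) ⟩
    ι (m ℤ.⊖ n)                         ≈⟨ ι-⊖ m n ⟩
    fromℕ m - fromℕ n                   ≈⟨ +-identityˡ _ ⟨
    0# + (fromℕ m - fromℕ n)            ≈⟨ +-congʳ (-‿inverseʳ 1#) ⟨
    (1# - 1#) + (fromℕ m - fromℕ n)     ≈⟨ +-interchange 1# (- 1#) (fromℕ m) (- fromℕ n) ⟩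
    (1# + fromℕ m) + (- 1# - fromℕ n)   ≈⟨ +-congˡ (-‿+-comm 1# (fromℕ n)) ⟩
    (1# + fromℕ m) - (1# + fromℕ n)     ∎

  ι-+ : ∀ i j → ι (i ℤ.+ j) ≈ ι i + ι j
  ι-+ (+ m)    (+ n)    = fromℕ-+ m n
  ι-+ (+ m)    -[1+ n ] = ι-⊖ m (suc n)
  ι-+ -[1+ m ] (+ n)    = trans (ι-⊖ n (suc m)) (+-comm _ _)
  ι-+ -[1+ m ] -[1+ n ] = begin
    - fromℕ (suc (suc (m ℕ.+ n)))       ≡⟨ ≡.cong (λ k → - fromℕ (suc k)) (ℕP.+-suc m n) ⟨
    - fromℕ (suc m ℕ.+ suc n)           ≈⟨ -‿cong (fromℕ-+ (suc m) (suc n)) ⟩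
    - (fromℕ (suc m) + fromℕ (suc n))   ≈⟨ -‿+-comm _ _ ⟨
    - fromℕ (suc m) - fromℕ (suc n)     ∎

  ι-*⁺ : ∀ m j → ι (+ m ℤ.* j) ≈ fromℕ m * ι j
  ι-*⁺ zero    j = sym (zeroˡ _)
  ι-*⁺ (suc m) j = begin
    ι (+ suc m ℤ.* j)                   ≡⟨ ≡.cong ι (ℤP.suc-* (+ m) j) ⟩
    ι (j ℤ.+ + m ℤ.* j)                 ≈⟨ ι-+ j (+ m ℤ.* j) ⟩
    ι j + ι (+ m ℤ.* j)                 ≈⟨ +-congˡ (ι-*⁺ m j) ⟩
    ι j + fromℕ m * ι j                 ≈⟨ +-congʳ (*-identityˡ _) ⟨
    1# * ι j + fromℕ m * ι j            ≈⟨ distribʳ _ _ _ ⟨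
    (1# + fromℕ m) * ι j                ∎

  ι-* : ∀ i j → ι (i ℤ.* j) ≈ ι i * ι j
  ι-* (+ m)    j = ι-*⁺ m j
  ι-* -[1+ m ] j = begin
    ι (-[1+ m ] ℤ.* j)                  ≡⟨ ≡.cong ι (ℤP.neg-distribˡ-* (+ suc m) j) ⟨
    ι (ℤ.- (+ suc m ℤ.* j))             ≈⟨ ι-neg (+ suc m ℤ.* j) ⟩
    - ι (+ suc m ℤ.* j)                 ≈⟨ -‿cong (ι-*⁺ (suc m) j) ⟩
    - (fromℕ (suc m) * ι j)             ≈⟨ -‿distribˡ-* _ _ ⟩
    - fromℕ (suc m) * ι j               ∎

  ι-homomorphism : CommutativeRing.rawRing ℤP.+-*-commutativeRing
                     ACR.-Raw-AlmostCommutative⟶ ACR.fromCommutativeRing commutativeRing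
  ι-homomorphism = record
    { ⟦_⟧ = ι ; +-homo = ι-+ ; *-homo = ι-* ; -‿homo = ι-neg
    ; 0-homo = refl ; 1-homo = +-identityʳ 1# }

  ι-≟ : ∀ i j → Maybe (ι i ≈ ι j)
  ι-≟ i j with i ℤ.≟ j
  ... | yes ≡.refl = just refl
  ... | no _       = nothing

  open import Algebra.Solver.Ring _ (ACR.fromCommutativeRing commutativeRing) ι-homomorphism ι-≟

  *-cancelˡ : ∀ {x y z} → ¬ (x ≈ 0#) → x * y ≈ x * z → y ≈ z
  *-cancelˡ {x} {y} {z} x≉0 xy≈xz = begin
    y                  ≈⟨ *-identityˡ y ⟨
    1# * y             ≈⟨ *-congʳ x⁻¹x≈1 ⟨
    (x ⁻¹ * x) * y     ≈⟨ *-assoc _ _ _ ⟩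
    x ⁻¹ * (x * y)     ≈⟨ *-congˡ xy≈xz ⟩
    x ⁻¹ * (x * z)     ≈⟨ *-assoc _ _ _ ⟨
    (x ⁻¹ * x) * z     ≈⟨ *-congʳ x⁻¹x≈1 ⟩
    1# * z             ≈⟨ *-identityˡ z ⟩
    z                  ∎
    where
    x⁻¹x≈1 : x ⁻¹ * x ≈ 1#
    x⁻¹x≈1 = trans (*-comm _ _) (⁻¹-inverse x x≉0)

  *-≉0 : ∀ {x y} → ¬ (x ≈ 0#) → ¬ (y ≈ 0#) → ¬ (x * y ≈ 0#)
  *-≉0 {x} x≉0 y≉0 xy≈0 = y≉0 (*-cancelˡ x≉0 (trans xy≈0 (sym (zeroʳ x))))

  -‿≉0 : ∀ {x} → ¬ (x ≈ 0#) → ¬ (- x ≈ 0#)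
  -‿≉0 x≉0 -x≈0 = x≉0 (trans (sym (-‿involutive _)) (trans (-‿cong -x≈0) -0#≈0#))

  ι≉0 : (∀ n → ¬ (fromℕ (suc n) ≈ 0#)) → ∀ i → i ≢ + 0 → ¬ (ι i ≈ 0#)
  ι≉0 char0 (+ zero)  i≢0 = λ _ → i≢0 ≡.refl
  ι≉0 char0 (+ suc n) i≢0 = char0 n
  ι≉0 char0 -[1+ n ]  i≢0 = -‿≉0 (char0 n)

  zpow-suc : ∀ {x} → ¬ (x ≈ 0#) → ∀ k → zpow x (ℤ.suc k) ≈ x * zpow x k
  zpow-suc x≉0 (+ n)            = refl
  zpow-suc {x} x≉0 -[1+ zero ]  = sym (trans (*-congˡ (*-identityʳ _)) (⁻¹-inverse x x≉0))
  zpow-suc {x} x≉0 -[1+ suc n ] = begin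
    pow (x ⁻¹) (suc n)                ≈⟨ *-identityˡ _ ⟨
    1# * pow (x ⁻¹) (suc n)           ≈⟨ *-congʳ (⁻¹-inverse x x≉0) ⟨
    (x * x ⁻¹) * pow (x ⁻¹) (suc n)   ≈⟨ *-assoc _ _ _ ⟩
    x * (x ⁻¹ * pow (x ⁻¹) (suc n))   ∎

  geometric-unique : ∀ {x} → ¬ (x ≈ 0#) → (f g : ℤ → Carrier) →
                     (∀ k → f (ℤ.suc k) ≈ x * f k) → (∀ k → g (ℤ.suc k) ≈ x * g k) →
                     f (+ 0) ≈ g (+ 0) → ∀ k → f k ≈ g k
  geometric-unique {x} x≉0 f g f-step g-step f0≈g0 =
    ℤ-induction (λ k → f k ≈ g k) f0≈g0 up down
    where
    up : ∀ k → f k ≈ g k → f (ℤ.suc k) ≈ g (ℤ.suc k)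
    up k fk≈gk = trans (f-step k) (trans (*-congˡ fk≈gk) (sym (g-step k)))
    down : ∀ k → f (ℤ.suc k) ≈ g (ℤ.suc k) → f k ≈ g k
    down k fk+1≈gk+1 = *-cancelˡ x≉0 (trans (sym (f-step k)) (trans fk+1≈gk+1 (g-step k)))

  zpow-+ : ∀ {x} → ¬ (x ≈ 0#) → ∀ i j → zpow x (i ℤ.+ j) ≈ zpow x i * zpow x j
  zpow-+ {x} x≉0 i j =
    geometric-unique x≉0 (λ i → zpow x (i ℤ.+ j)) (λ i → zpow x i * zpow x j)
      (λ i → trans (reflexive (≡.cong (zpow x) (ℤP.+-assoc (+ 1) i j))) (zpow-suc x≉0 (i ℤ.+ j)))
      (λ i → trans (*-congʳ (zpow-suc x≉0 i)) (*-assoc _ _ _))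
      (trans (reflexive (≡.cong (zpow x) (ℤP.+-identityˡ j))) (sym (*-identityˡ _))) i

  zpow-* : ∀ {x y} → ¬ (x ≈ 0#) → ¬ (y ≈ 0#) → ∀ k → zpow (x * y) k ≈ zpow x k * zpow y k
  zpow-* {x} {y} x≉0 y≉0 =
    geometric-unique (*-≉0 x≉0 y≉0) (zpow (x * y)) (λ k → zpow x k * zpow y k)
      (zpow-suc (*-≉0 x≉0 y≉0))
      (λ k → trans (*-cong (zpow-suc x≉0 k) (zpow-suc y≉0 k)) (*-interchange x _ y _))
      (sym (*-identityˡ 1#))

  zpow-cong : ∀ {x y} → ¬ (x ≈ 0#) → x ≈ y → ∀ k → zpow x k ≈ zpow y k
  zpow-cong {x} {y} x≉0 x≈y = geometric-unique x≉0 (zpow x) (zpow y) (zpow-suc x≉0)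
    (λ k → trans (zpow-suc (λ y≈0 → x≉0 (trans x≈y y≈0)) k) (*-congʳ (sym x≈y))) refl

  module HalfSums {P Q : Carrier} (2≉0 : ¬ (ι (+ 2) ≈ 0#)) where

    4≉0 : ¬ (ι (+ 2) * ι (+ 2) ≈ 0#)
    4≉0 = *-≉0 2≉0 2≉0

    half-sum-root : ∀ {e x} → e * e ≈ P * P + ι (+ 4) * Q → ι (+ 2) * x ≈ P + e →
                    x * x ≈ P * x + Q
    half-sum-root {e} {x} e²≈Δ 2x≈P+e = *-cancelˡ 4≉0 (begin
      ι (+ 2) * ι (+ 2) * (x * x)
        ≈⟨ solve 1 (λ x → con (+ 2) :* con (+ 2) :* (x :* x)
                          := (con (+ 2) :* x) :* (con (+ 2) :* x)) refl x ⟩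
      (ι (+ 2) * x) * (ι (+ 2) * x)
        ≈⟨ *-cong 2x≈P+e 2x≈P+e ⟩
      (P + e) * (P + e)
        ≈⟨ solve 2 (λ P e → (P :+ e) :* (P :+ e) := P :* P :+ con (+ 2) :* P :* e :+ e :* e)
                 refl P e ⟩
      P * P + ι (+ 2) * P * e + e * e
        ≈⟨ +-congˡ e²≈Δ ⟩
      P * P + ι (+ 2) * P * e + (P * P + ι (+ 4) * Q)
        ≈⟨ solve 3 (λ P e Q → P :* P :+ con (+ 2) :* P :* e :+ (P :* P :+ con (+ 4) :* Q)
                              := con (+ 2) :* P :* (P :+ e) :+ con (+ 4) :* Q) refl P e Q ⟩
      ι (+ 2) * P * (P + e) + ι (+ 4) * Q
        ≈⟨ +-congʳ (*-congˡ 2x≈P+e) ⟨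
      ι (+ 2) * P * (ι (+ 2) * x) + ι (+ 4) * Q
        ≈⟨ solve 3 (λ P x Q → con (+ 2) :* P :* (con (+ 2) :* x) :+ con (+ 4) :* Q
                              := con (+ 2) :* con (+ 2) :* (P :* x :+ Q)) refl P x Q ⟩
      ι (+ 2) * ι (+ 2) * (P * x + Q) ∎)

    module _ {e x y} (e²≈Δ : e * e ≈ P * P + ι (+ 4) * Q)
             (2x≈P+e : ι (+ 2) * x ≈ P + e) (2y≈P-e : ι (+ 2) * y ≈ P - e) where

      half-sums-difference : x - y ≈ e
      half-sums-difference = *-cancelˡ 2≉0 (begin
        ι (+ 2) * (x - y)           ≈⟨ x[y-z]≈xy-xz _ x y ⟩
        ι (+ 2) * x - ι (+ 2) * y   ≈⟨ +-cong 2x≈P+e (-‿cong 2y≈P-e) ⟩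
        (P + e) - (P - e)           ≈⟨ solve 2 (λ P e → (P :+ e) :- (P :- e) := con (+ 2) :* e) refl P e ⟩
        ι (+ 2) * e                 ∎)

      half-sums-product : x * y ≈ - Q
      half-sums-product = *-cancelˡ 4≉0 (begin
        ι (+ 2) * ι (+ 2) * (x * y)
          ≈⟨ solve 2 (λ x y → con (+ 2) :* con (+ 2) :* (x :* y)
                              := (con (+ 2) :* x) :* (con (+ 2) :* y)) refl x y ⟩
        (ι (+ 2) * x) * (ι (+ 2) * y)
          ≈⟨ *-cong 2x≈P+e 2y≈P-e ⟩
        (P + e) * (P - e)
          ≈⟨ solve 2 (λ P e → (P :+ e) :* (P :- e) := P :* P :- e :* e) refl P e ⟩
        P * P - e * e
          ≈⟨ +-congˡ (-‿cong e²≈Δ) ⟩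
        P * P - (P * P + ι (+ 4) * Q)
          ≈⟨ solve 2 (λ P Q → P :* P :- (P :* P :+ con (+ 4) :* Q)
                              := con (+ 2) :* con (+ 2) :* (:- Q)) refl P Q ⟩
        ι (+ 2) * ι (+ 2) * (- Q) ∎)

      half-sums-root₁ : x * x ≈ P * x + Q
      half-sums-root₁ = half-sum-root e²≈Δ 2x≈P+e

      half-sums-root₂ : y * y ≈ P * y + Q
      half-sums-root₂ =
        half-sum-root (trans (solve 1 (λ e → (:- e) :* (:- e) := e :* e) refl e) e²≈Δ) 2y≈P-e

  zpow-root-recurrence : ∀ {x P Q} → ¬ (x ≈ 0#) → x * x ≈ P * x + Q →
                         ∀ k → zpow x (ℤ.suc (ℤ.suc k)) ≈ P * zpow x (ℤ.suc k) + Q * zpow x k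
  zpow-root-recurrence {x} {P} {Q} x≉0 x²≈Px+Q k = begin
    zpow x (ℤ.suc (ℤ.suc k))              ≈⟨ zpow-suc x≉0 (ℤ.suc k) ⟩
    x * zpow x (ℤ.suc k)                  ≈⟨ *-congˡ (zpow-suc x≉0 k) ⟩
    x * (x * zpow x k)                    ≈⟨ *-assoc _ _ _ ⟨
    (x * x) * zpow x k                    ≈⟨ *-congʳ x²≈Px+Q ⟩
    (P * x + Q) * zpow x k                ≈⟨ distribʳ _ _ _ ⟩
    (P * x) * zpow x k + Q * zpow x k     ≈⟨ +-congʳ (*-assoc _ _ _) ⟩
    P * (x * zpow x k) + Q * zpow x k     ≈⟨ +-congʳ (*-congˡ (zpow-suc x≉0 k)) ⟨
    P * zpow x (ℤ.suc k) + Q * zpow x k   ∎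

  module Binet (p q a₀ a₁ : ℤ) {s α β : Carrier} (q≉0 : ¬ (ι q ≈ 0#))
               (α≉0 : ¬ (α ≈ 0#)) (β≉0 : ¬ (β ≈ 0#))
               (α-root : α * α ≈ ι p * α + ι q) (β-root : β * β ≈ ι p * β + ι q)
               (α-β≈s : α - β ≈ s) where
    open Horadam p q a₀ a₁

    A B : Carrier
    A = ι a₁ - ι a₀ * β
    B = ι a₁ - ι a₀ * α

    binet : ℤ → Carrier
    binet k = A * zpow α k - B * zpow β k

    binet-recurrence : ∀ k → binet (ℤ.suc (ℤ.suc k)) ≈ ι p * binet (ℤ.suc k) + ι q * binet k
    binet-recurrence k = begin
      A * zpow α (ℤ.suc (ℤ.suc k)) - B * zpow β (ℤ.suc (ℤ.suc k))
        ≈⟨ +-cong (*-congˡ (zpow-root-recurrence α≉0 α-root k))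
                  (-‿cong (*-congˡ (zpow-root-recurrence β≉0 β-root k))) ⟩
      A * (ι p * zpow α (ℤ.suc k) + ι q * zpow α k) - B * (ι p * zpow β (ℤ.suc k) + ι q * zpow β k)
        ≈⟨ solve 8 (λ A B P Q x₁ x₀ y₁ y₀ →
                      A :* (P :* x₁ :+ Q :* x₀) :- B :* (P :* y₁ :+ Q :* y₀)
                      := P :* (A :* x₁ :- B :* y₁) :+ Q :* (A :* x₀ :- B :* y₀))
                   refl A B _ _ _ _ _ _ ⟩
      ι p * binet (ℤ.suc k) + ι q * binet k ∎

    BinetPair : ℤ → Carrier × Carrier → Set ℓ
    BinetPair k uv = s * proj₁ uv ≈ binet k × s * proj₂ uv ≈ binet (ℤ.suc k)

    binet-initial : BinetPair (+ 0) (ι a₀ , ι a₁)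
    binet-initial = sym (begin
      A * 1# - B * 1#               ≈⟨ +-cong (*-identityʳ A) (-‿cong (*-identityʳ B)) ⟩
      A - B                         ≈⟨ solve 4 (λ a₀ a₁ α β → (a₁ :- a₀ :* β) :- (a₁ :- a₀ :* α)
                                                            := a₀ :* (α :- β)) refl _ _ α β ⟩
      ι a₀ * (α - β)                ≈⟨ *-congˡ α-β≈s ⟩
      ι a₀ * s                      ≈⟨ *-comm _ _ ⟩
      s * ι a₀                      ∎)
      , sym (begin
      A * (α * 1#) - B * (β * 1#)   ≈⟨ +-cong (*-congˡ (*-identityʳ α)) (-‿cong (*-congˡ (*-identityʳ β))) ⟩
      A * α - B * β                 ≈⟨ solve 4 (λ a₀ a₁ α β → (a₁ :- a₀ :* β) :* α :- (a₁ :- a₀ :* α) :* β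
                                                            := (α :- β) :* a₁) refl _ _ α β ⟩
      (α - β) * ι a₁                ≈⟨ *-congʳ α-β≈s ⟩
      s * ι a₁                      ∎)

    binet-forward : ∀ {k u v} → BinetPair k (u , v) → BinetPair (ℤ.suc k) (v , ι p * v + ι q * u)
    binet-forward {k} {u} {v} (su≈bₖ , sv≈bₖ₊₁) = sv≈bₖ₊₁ , (begin
      s * (ι p * v + ι q * u)
        ≈⟨ solve 5 (λ s P Q u v → s :* (P :* v :+ Q :* u) := P :* (s :* v) :+ Q :* (s :* u))
                 refl s _ _ u v ⟩
      ι p * (s * v) + ι q * (s * u)           ≈⟨ +-cong (*-congˡ sv≈bₖ₊₁) (*-congˡ su≈bₖ) ⟩
      ι p * binet (ℤ.suc k) + ι q * binet k   ≈⟨ binet-recurrence k ⟨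
      binet (ℤ.suc (ℤ.suc k))                 ∎)

    binet-backward : ∀ {k u v} → BinetPair (ℤ.suc k) (u , v) →
                     BinetPair k ((v - ι p * u) * ι q ⁻¹ , u)
    binet-backward {k} {u} {v} (su≈bₖ₊₁ , sv≈bₖ₊₂) = (begin
      s * ((v - ι p * u) * ι q ⁻¹)
        ≈⟨ solve 5 (λ s v P u t → s :* ((v :- P :* u) :* t) := (s :* v :- P :* (s :* u)) :* t)
                 refl s v _ u _ ⟩
      (s * v - ι p * (s * u)) * ι q ⁻¹
        ≈⟨ *-congʳ (+-cong (trans sv≈bₖ₊₂ (binet-recurrence k)) (-‿cong (*-congˡ su≈bₖ₊₁))) ⟩
      (ι p * binet (ℤ.suc k) + ι q * binet k - ι p * binet (ℤ.suc k)) * ι q ⁻¹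
        ≈⟨ solve 4 (λ x y z t → (x :+ y :* z :- x) :* t := z :* (y :* t)) refl _ _ _ _ ⟩
      binet k * (ι q * ι q ⁻¹)   ≈⟨ *-congˡ (⁻¹-inverse (ι q) q≉0) ⟩
      binet k * 1#               ≈⟨ *-identityʳ _ ⟩
      binet k                    ∎)
      , su≈bₖ₊₁

    fwd-binet : ∀ n → BinetPair (+ n) (fwd n)
    fwd-binet zero = binet-initial
    fwd-binet (suc n) with fwd n | fwd-binet n
    ... | (u , v) | pair = binet-forward {+ n} pair

    bwd-binet : ∀ n → BinetPair (ℤ.- (+ n)) (bwd n)
    bwd-binet zero = binet-initial
    bwd-binet (suc n) with bwd n | bwd-binet n
    ... | (u , v) | pair =
      binet-backward {ℤ.- (+ suc n)} (≡.subst (λ k → BinetPair k (u , v)) (≡.sym (suc-neg-suc n)) pair)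

    w-binet : ∀ k → s * w k ≈ binet k
    w-binet (+ n)    = proj₁ (fwd-binet n)
    w-binet -[1+ n ] = proj₁ (bwd-binet (suc n))

  lincomb-*ʳ : ∀ {e c d x X Y} z → e * x ≈ c * X - d * Y → e * (x * z) ≈ c * (X * z) - d * (Y * z)
  lincomb-*ʳ {e} {c} {d} {x} {X} {Y} z ex≈cX-dY = begin
    e * (x * z)                  ≈⟨ *-assoc _ _ _ ⟨
    (e * x) * z                  ≈⟨ *-congʳ ex≈cX-dY ⟩
    (c * X - d * Y) * z          ≈⟨ solve 5 (λ c d X Y z → (c :* X :- d :* Y) :* z
                                                        := c :* (X :* z) :- d :* (Y :* z)) refl c d X Y z ⟩
    c * (X * z) - d * (Y * z)    ∎

  lincomb-*ˡ : ∀ {e c d y X Y} z → e * y ≈ c * X - d * Y → e * (z * y) ≈ c * (z * X) - d * (z * Y)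
  lincomb-*ˡ {e} {c} {d} {y} {X} {Y} z ey≈cX-dY = begin
    e * (z * y)                  ≈⟨ *-congˡ (*-comm z y) ⟩
    e * (y * z)                  ≈⟨ lincomb-*ʳ z ey≈cX-dY ⟩
    c * (X * z) - d * (Y * z)    ≈⟨ +-cong (*-congˡ (*-comm X z)) (-‿cong (*-congˡ (*-comm Y z))) ⟩
    c * (z * X) - d * (z * Y)    ∎

  -- (c₁ u₁ − c₂ u₂)(d₁ v₁ − d₂ v₂) expanded, with X Y Z T standing for u₁v₁, u₁v₂, u₂v₁, u₂v₂.
  cross : (c₁ c₂ d₁ d₂ X Y Z T : Carrier) → Carrier
  cross c₁ c₂ d₁ d₂ X Y Z T = c₁ * (d₁ * X - d₂ * Y) - c₂ * (d₁ * Z - d₂ * T)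

  cross-cong : ∀ {c₁ c₂ d₁ d₂ c₁′ c₂′ d₁′ d₂′} X Y Z T →
               c₁ ≈ c₁′ → c₂ ≈ c₂′ → d₁ ≈ d₁′ → d₂ ≈ d₂′ →
               cross c₁ c₂ d₁ d₂ X Y Z T ≈ cross c₁′ c₂′ d₁′ d₂′ X Y Z T
  cross-cong X Y Z T c₁≈ c₂≈ d₁≈ d₂≈ =
    +-cong (*-cong c₁≈ (+-cong (*-congʳ d₁≈) (-‿cong (*-congʳ d₂≈))))
           (-‿cong (*-cong c₂≈ (+-cong (*-congʳ d₁≈) (-‿cong (*-congʳ d₂≈)))))

  cross-swap : ∀ c₁ c₂ d₁ d₂ X Y Z T → cross c₁ c₂ d₁ d₂ X Y Z T ≈ cross d₁ d₂ c₁ c₂ X Z Y T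
  cross-swap = solve 8 (λ c₁ c₂ d₁ d₂ X Y Z T →
    c₁ :* (d₁ :* X :- d₂ :* Y) :- c₂ :* (d₁ :* Z :- d₂ :* T)
      := d₁ :* (c₁ :* X :- c₂ :* Z) :- d₂ :* (c₁ :* Y :- c₂ :* T)) refl

  module SymbolBilinear (N : ℕ) (ω a b : Carrier) where
    open Symbol N ω a b

    sumTo-lincomb : ∀ n {e c d f g h} → (∀ i → e * f i ≈ c * g i - d * h i) →
                    e * sumTo n f ≈ c * sumTo n g - d * sumTo n h
    sumTo-lincomb zero {e} {c} {d} _ =
      solve 3 (λ e c d → e :* con (+ 0) := c :* con (+ 0) :- d :* con (+ 0)) refl e c d
    sumTo-lincomb (suc n) {e} {c} {d} {f} {g} {h} pointwise = begin
      e * (sumTo n f + f n)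
        ≈⟨ distribˡ _ _ _ ⟩
      e * sumTo n f + e * f n
        ≈⟨ +-cong (sumTo-lincomb n pointwise) (pointwise n) ⟩
      (c * sumTo n g - d * sumTo n h) + (c * g n - d * h n)
        ≈⟨ solve 6 (λ c d G H g h → (c :* G :- d :* H) :+ (c :* g :- d :* h)
                                    := c :* (G :+ g) :- d :* (H :+ h)) refl c d _ _ _ _ ⟩
      c * (sumTo n g + g n) - d * (sumTo n h + h n) ∎

    ⊛-linearˡ : ∀ {e c d u U V} v → (∀ i j → e * u i j ≈ c * U i j - d * V i j) →
                ∀ m n → e * (u ⊛ v) m n ≈ c * (U ⊛ v) m n - d * (V ⊛ v) m n
    ⊛-linearˡ v pointwise m n = sumTo-lincomb N λ i → sumTo-lincomb N λ j →
      lincomb-*ʳ _ (lincomb-*ʳ _ (lincomb-*ʳ _ (lincomb-*ʳ _ (pointwise i j))))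

    ⊛-linearʳ : ∀ {e c d v V W} u → (∀ i j → e * v i j ≈ c * V i j - d * W i j) →
                ∀ m n → e * (u ⊛ v) m n ≈ c * (u ⊛ V) m n - d * (u ⊛ W) m n
    ⊛-linearʳ u pointwise m n = sumTo-lincomb N λ i → sumTo-lincomb N λ j →
      lincomb-*ʳ _ (lincomb-*ʳ _ (lincomb-*ʳ _ (lincomb-*ˡ _ (pointwise _ _))))

    ⊛-bilinear : ∀ {e c₁ c₂ d₁ d₂ u v U₁ U₂ V₁ V₂} →
                 (∀ i j → e * u i j ≈ c₁ * U₁ i j - c₂ * U₂ i j) →
                 (∀ i j → e * v i j ≈ d₁ * V₁ i j - d₂ * V₂ i j) →
                 ∀ m n → e * e * (u ⊛ v) m n
                         ≈ cross c₁ c₂ d₁ d₂ ((U₁ ⊛ V₁) m n) ((U₁ ⊛ V₂) m n) ((U₂ ⊛ V₁) m n) ((U₂ ⊛ V₂) m n)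
    ⊛-bilinear {e} {c₁} {c₂} {d₁} {d₂} {u} {v} {U₁} {U₂} {V₁} {V₂} u≈ v≈ m n = begin
      e * e * (u ⊛ v) m n
        ≈⟨ *-assoc _ _ _ ⟩
      e * (e * (u ⊛ v) m n)
        ≈⟨ *-congˡ (⊛-linearˡ v u≈ m n) ⟩
      e * (c₁ * (U₁ ⊛ v) m n - c₂ * (U₂ ⊛ v) m n)
        ≈⟨ solve 5 (λ e c₁ c₂ x y → e :* (c₁ :* x :- c₂ :* y) := c₁ :* (e :* x) :- c₂ :* (e :* y))
                 refl e c₁ c₂ _ _ ⟩
      c₁ * (e * (U₁ ⊛ v) m n) - c₂ * (e * (U₂ ⊛ v) m n)
        ≈⟨ +-cong (*-congˡ (⊛-linearʳ U₁ v≈ m n)) (-‿cong (*-congˡ (⊛-linearʳ U₂ v≈ m n))) ⟩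
      cross c₁ c₂ d₁ d₂ ((U₁ ⊛ V₁) m n) ((U₁ ⊛ V₂) m n) ((U₂ ⊛ V₁) m n) ((U₂ ⊛ V₂) m n) ∎

  catalan-polynomial : ∀ A B E F G H X Y Z T →
    cross (A * E) (B * F) (A * (E * G * G)) (B * (F * H * H)) X Y Z T
      - cross (A * (E * G)) (B * (F * H)) (A * (E * G)) (B * (F * H)) X Y Z T
    ≈ A * B * (E * F) * (G - H) * (H * Y - G * Z)
  catalan-polynomial = solve 10 (λ A B E F G H X Y Z T →
    (A :* E :* (A :* (E :* G :* G) :* X :- B :* (F :* H :* H) :* Y)
       :- B :* F :* (A :* (E :* G :* G) :* Z :- B :* (F :* H :* H) :* T))
    :- (A :* (E :* G) :* (A :* (E :* G) :* X :- B :* (F :* H) :* Y)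
       :- B :* (F :* H) :* (A :* (E :* G) :* Z :- B :* (F :* H) :* T))
    := A :* B :* (E :* F) :* (G :- H) :* (H :* Y :- G :* Z)) refl

  module Catalan (p q a₀ a₁ : ℤ) {s α β : Carrier}
                 (2≉0 : ¬ (ι (+ 2) ≈ 0#)) (q≉0 : ¬ (ι q ≈ 0#))
                 (s²≈Δ : s * s ≈ ι (p ℤ.* p ℤ.+ + 4 ℤ.* q))
                 (2α≈p+s : (1# + 1#) * α ≈ ι p + s) (2β≈p-s : (1# + 1#) * β ≈ ι p - s)
                 (N : ℕ) (ω a b : Carrier) where
    open HalfSums {ι p} {ι q} 2≉0

    ι2α≈p+s : ι (+ 2) * α ≈ ι p + s
    ι2α≈p+s = trans (*-congʳ (+-congˡ (+-identityʳ 1#))) 2α≈p+s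

    ι2β≈p-s : ι (+ 2) * β ≈ ι p - s
    ι2β≈p-s = trans (*-congʳ (+-congˡ (+-identityʳ 1#))) 2β≈p-s

    s²≈p²+4q : s * s ≈ ι p * ι p + ι (+ 4) * ι q
    s²≈p²+4q = trans s²≈Δ (trans (ι-+ (p ℤ.* p) (+ 4 ℤ.* q)) (+-cong (ι-* p p) (ι-* (+ 4) q)))

    αβ≈-q : α * β ≈ - ι q
    αβ≈-q = half-sums-product s²≈p²+4q ι2α≈p+s ι2β≈p-s

    αβ≉0 : ¬ (α * β ≈ 0#)
    αβ≉0 αβ≈0 = -‿≉0 q≉0 (trans (sym αβ≈-q) αβ≈0)

    α≉0 : ¬ (α ≈ 0#)
    α≉0 α≈0 = αβ≉0 (trans (*-congʳ α≈0) (zeroˡ β))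

    β≉0 : ¬ (β ≈ 0#)
    β≉0 β≈0 = αβ≉0 (trans (*-congˡ β≈0) (zeroʳ α))

    open Binet p q a₀ a₁ q≉0 α≉0 β≉0
      (half-sums-root₁ s²≈p²+4q ι2α≈p+s ι2β≈p-s) (half-sums-root₂ s²≈p²+4q ι2α≈p+s ι2β≈p-s)
      (half-sums-difference s²≈p²+4q ι2α≈p+s ι2β≈p-s)
    open Horadam p q a₀ a₁
    open Symbol N ω a b
    open SymbolBilinear N ω a b

    W : ℤ → Elt
    W k = fromSeq (λ l → w (k ℤ.+ + l))

    α̲ β̲ : Elt
    α̲ = fromSeq (pow α)
    β̲ = fromSeq (pow β)

    W-decomposition : ∀ k i j → s * W k i j ≈ (A * zpow α k) * α̲ i j - (B * zpow β k) * β̲ i j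
    W-decomposition k i j = trans (w-binet (k ℤ.+ + l)) (+-cong (shift α≉0 A) (-‿cong (shift β≉0 B)))
      where
      l = j ℕ.* N ℕ.+ i
      shift : ∀ {x} → ¬ (x ≈ 0#) → ∀ C → C * zpow x (k ℤ.+ + l) ≈ (C * zpow x k) * pow x l
      shift x≉0 C = trans (*-congˡ (zpow-+ x≉0 k (+ l))) (sym (*-assoc _ _ _))

    Δ-product : ∀ u v m k →
      ι (p ℤ.* p ℤ.+ + 4 ℤ.* q) * (W u ⊛ W v) m k
        ≈ cross (A * zpow α u) (B * zpow β u) (A * zpow α v) (B * zpow β v)
                ((α̲ ⊛ α̲) m k) ((α̲ ⊛ β̲) m k) ((β̲ ⊛ α̲) m k) ((β̲ ⊛ β̲) m k)
    Δ-product u v m k =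
      trans (*-congʳ (sym s²≈Δ)) (⊛-bilinear (W-decomposition u) (W-decomposition v) m k)

    module _ (n r : ℤ) where
      α^[n-r] β^[n-r] α^r β^r : Carrier
      α^[n-r] = zpow α (n ℤ.- r)
      β^[n-r] = zpow β (n ℤ.- r)
      α^r     = zpow α r
      β^r     = zpow β r

      zpow-split : ∀ {x} → ¬ (x ≈ 0#) → zpow x n ≈ zpow x (n ℤ.- r) * zpow x r
      zpow-split x≉0 =
        trans (reflexive (≡.cong (zpow _) (≡.sym (i-j+j≡i n r)))) (zpow-+ x≉0 (n ℤ.- r) r)

      zpow-split₂ : ∀ {x} → ¬ (x ≈ 0#) → zpow x (n ℤ.+ r) ≈ zpow x (n ℤ.- r) * zpow x r * zpow x r
      zpow-split₂ x≉0 =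
        trans (reflexive (≡.cong (λ i → zpow _ (i ℤ.+ r)) (≡.sym (i-j+j≡i n r))))
              (trans (zpow-+ x≉0 (n ℤ.- r ℤ.+ r) r) (*-congʳ (zpow-+ x≉0 (n ℤ.- r) r)))

      -q^[n-r]≈αβ^[n-r] : zpow (ι (ℤ.- q)) (n ℤ.- r) ≈ α^[n-r] * β^[n-r]
      -q^[n-r]≈αβ^[n-r] = trans (sym (zpow-cong αβ≉0 (trans αβ≈-q (sym (ι-neg q))) (n ℤ.- r)))
                                (zpow-* α≉0 β≉0 (n ℤ.- r))

      catalan-difference : ∀ X Y Z T →
        cross (A * α^[n-r]) (B * β^[n-r]) (A * zpow α (n ℤ.+ r)) (B * zpow β (n ℤ.+ r)) X Y Z T
          - cross (A * zpow α n) (B * zpow β n) (A * zpow α n) (B * zpow β n) X Y Z T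
        ≈ A * B * zpow (ι (ℤ.- q)) (n ℤ.- r) * (α^r - β^r) * (β^r * Y - α^r * Z)
      catalan-difference X Y Z T = begin
        cross (A * α^[n-r]) (B * β^[n-r]) (A * zpow α (n ℤ.+ r)) (B * zpow β (n ℤ.+ r)) X Y Z T
          - cross (A * zpow α n) (B * zpow β n) (A * zpow α n) (B * zpow β n) X Y Z T
          ≈⟨ +-cong (cross-cong X Y Z T refl refl (*-congˡ (zpow-split₂ α≉0)) (*-congˡ (zpow-split₂ β≉0)))
                    (-‿cong (cross-cong X Y Z T Aαⁿ Bβⁿ Aαⁿ Bβⁿ)) ⟩
        cross (A * α^[n-r]) (B * β^[n-r]) (A * (α^[n-r] * α^r * α^r)) (B * (β^[n-r] * β^r * β^r)) X Y Z T
          - cross (A * (α^[n-r] * α^r)) (B * (β^[n-r] * β^r))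
                  (A * (α^[n-r] * α^r)) (B * (β^[n-r] * β^r)) X Y Z T
          ≈⟨ catalan-polynomial A B α^[n-r] β^[n-r] α^r β^r X Y Z T ⟩
        A * B * (α^[n-r] * β^[n-r]) * (α^r - β^r) * (β^r * Y - α^r * Z)
          ≈⟨ *-congʳ (*-congʳ (*-congˡ (sym -q^[n-r]≈αβ^[n-r]))) ⟩
        A * B * zpow (ι (ℤ.- q)) (n ℤ.- r) * (α^r - β^r) * (β^r * Y - α^r * Z) ∎
        where
        Aαⁿ : A * zpow α n ≈ A * (α^[n-r] * α^r)
        Aαⁿ = *-congˡ (zpow-split α≉0)
        Bβⁿ : B * zpow β n ≈ B * (β^[n-r] * β^r)
        Bβⁿ = *-congˡ (zpow-split β≉0)

      module _ (i j : ℕ) where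
        αα αβ βα ββ : Carrier
        αα = (α̲ ⊛ α̲) i j
        αβ = (α̲ ⊛ β̲) i j
        βα = (β̲ ⊛ α̲) i j
        ββ = (β̲ ⊛ β̲) i j

        Δ-product-difference : ∀ u v → ι (p ℤ.* p ℤ.+ + 4 ℤ.* q) * ((W u ⊛ W v) i j - (W n ⊛ W n) i j)
          ≈ cross (A * zpow α u) (B * zpow β u) (A * zpow α v) (B * zpow β v) αα αβ βα ββ
            - cross (A * zpow α n) (B * zpow β n) (A * zpow α n) (B * zpow β n) αα αβ βα ββ
        Δ-product-difference u v =
          trans (x[y-z]≈xy-xz _ _ _) (+-cong (Δ-product u v i j) (-‿cong (Δ-product n n i j)))

        catalanᵃ : ι (p ℤ.* p ℤ.+ + 4 ℤ.* q) * ((W (n ℤ.- r) ⊛ W (n ℤ.+ r)) i j - (W n ⊛ W n) i j)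
                   ≈ A * B * zpow (ι (ℤ.- q)) (n ℤ.- r) * (α^r - β^r) * (β^r * αβ - α^r * βα)
        catalanᵃ = trans (Δ-product-difference (n ℤ.- r) (n ℤ.+ r)) (catalan-difference αα αβ βα ββ)

        catalanᵇ : ι (p ℤ.* p ℤ.+ + 4 ℤ.* q) * ((W (n ℤ.+ r) ⊛ W (n ℤ.- r)) i j - (W n ⊛ W n) i j)
                   ≈ A * B * zpow (ι (ℤ.- q)) (n ℤ.- r) * (α^r - β^r) * (β^r * βα - α^r * αβ)
        catalanᵇ = begin
          ι (p ℤ.* p ℤ.+ + 4 ℤ.* q) * ((W (n ℤ.+ r) ⊛ W (n ℤ.- r)) i j - (W n ⊛ W n) i j)
            ≈⟨ Δ-product-difference (n ℤ.+ r) (n ℤ.- r) ⟩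
          _ ≈⟨ +-cong (cross-swap _ _ _ _ _ _ _ _) (-‿cong (cross-swap _ _ _ _ _ _ _ _)) ⟩
          _ ≈⟨ catalan-difference αα βα αβ ββ ⟩
          A * B * zpow (ι (ℤ.- q)) (n ℤ.- r) * (α^r - β^r) * (β^r * βα - α^r * αβ) ∎

theorem3p11 :
  ∀ {c ℓ} (F : Field c ℓ) →
  let open Field F
      open Ops F
  in
  -- K has characteristic 0 (it contains ℝ)
  (∀ n → ¬ (fromℕ (ℕ.suc n) ≈ 0#)) →
  (p q a₀ a₁ : ℤ) → q ≢ + 0 → ℤ.+ 0 ℤ.< p ℤ.* p ℤ.+ + 4 ℤ.* q →
  -- s = √Δ ∈ K, α = (p + √Δ)/2, β = (p - √Δ)/2
  (s α β : Carrier) →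
  s * s ≈ ι (p ℤ.* p ℤ.+ + 4 ℤ.* q) →
  (1# + 1#) * α ≈ ι p + s →
  (1# + 1#) * β ≈ ι p - s →
  (N : ℕ) → 1 ℕ.≤ N →
  (ω a b : Carrier) → PrimitiveRoot ω N → ¬ (a ≈ 0#) → ¬ (b ≈ 0#) →
  let open Horadam p q a₀ a₁
      open Symbol N ω a b
      Δ  = ι (p ℤ.* p ℤ.+ + 4 ℤ.* q)
      A  = ι a₁ - ι a₀ * β
      B  = ι a₁ - ι a₀ * α
      W  = λ (k : ℤ) → fromSeq (λ l → w (k ℤ.+ + l))
      α̲ = fromSeq (pow α)
      β̲ = fromSeq (pow β)
  in
  (n r : ℤ) →
  -- (a)  Δ (W_{n-r} W_{n+r} - W_n²) = AB(-q)^{n-r}(α^r-β^r)(β^r α̲β̲ - α^r β̲α̲)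
  (Δ · ((W (n ℤ.- r) ⊛ W (n ℤ.+ r)) ⊖ (W n ⊛ W n))
    ≋ ((A * B * zpow (ι (ℤ.- q)) (n ℤ.- r) * (zpow α r - zpow β r))
        · ((zpow β r · (α̲ ⊛ β̲)) ⊖ (zpow α r · (β̲ ⊛ α̲)))))
  ×
  -- (b)  Δ (W_{n+r} W_{n-r} - W_n²) = AB(-q)^{n-r}(α^r-β^r)(β^r β̲α̲ - α^r α̲β̲)
  (Δ · ((W (n ℤ.+ r) ⊛ W (n ℤ.- r)) ⊖ (W n ⊛ W n))
    ≋ ((A * B * zpow (ι (ℤ.- q)) (n ℤ.- r) * (zpow α r - zpow β r))
        · ((zpow β r · (β̲ ⊛ α̲)) ⊖ (zpow α r · (α̲ ⊛ β̲)))))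
theorem3p11 F char0 p q a₀ a₁ q≢0 _ s α β s²≈Δ 2α≈p+s 2β≈p-s N _ ω a b _ _ _ n r =
  (λ i j _ _ → catalanᵃ n r i j) , (λ i j _ _ → catalanᵇ n r i j)
  where
  open FieldTheory F
  open Catalan p q a₀ a₁ (char0 1) (ι≉0 char0 q q≢0) s²≈Δ 2α≈p+s 2β≈p-s N ω a b
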